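{- Let $s > r \geq 2$ be integers. If $G$ is an $n$-vertex $K_s$-saturated graph with minimum degree $\delta(G) = s-2$, then $G$ is isomorphic to $K_{s-2} + \overline{K_{n-s+2}}$ and consequently $G$ has exactly \[ \binom{s-2}{r} + (n-s+2)\binom{s-2}{r-1} \] copies of $K_r$.
   Context: A graph $G$ is $K_s$-saturated if $G$ contains no copy of $K_s$ but adding any edge between two nonadjacent vertices of $G$ creates a copy of $K_s$. $K_{s-2} + \overline{K_{n-s+2}}$ denotes the join of a clique on $s-2$ vertices with an independent set on $n-s+2$ vertices (every vertex of the clique adjacent to every vertex of the independent set). -}

module Defs where

open import Data.Nat using (ℕ; zero; suc; _<_; _≤_; _∸_; _≥_)
open import Data.Nat.Properties using (_≟_; _<?_)
open import Data.Bool using (Bool; true; false; _∧_; not; _∨_)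
import Data.Bool.Properties as BoolP
open import Data.Fin using (Fin; toℕ)
import Data.Fin.Properties as FinP
open import Data.Fin.Subset using (Subset; _∈_; ∣_∣; inside; outside)
open import Data.Fin.Subset.Properties using (_∈?_)
open import Data.Vec using ([]; _∷_)
open import Data.List using (List; []; _∷_; map; _++_; length; filter; allFin)
open import Data.Product using (Σ; ∃; _×_; _,_)
open import Data.Sum using (_⊎_)
open import Relation.Binary.PropositionalEquality using (_≡_; _≢_; refl)
import Relation.Binary.PropositionalEquality as PE
open import Data.Empty using (⊥-elim)
open import Relation.Nullary using (Dec; ¬_; does; yes; no)
open import Relation.Nullary.Decidable using (_×-dec_; _→-dec_; ¬?)
open import Function.Bundles using (_↔_; Inverse)

record Graph (n : ℕ) : Set where
  field
    edge   : Fin n → Fin n → Bool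
    sym    : ∀ i j → edge i j ≡ edge j i
    irrefl : ∀ i → edge i i ≡ false

open Graph public

Adj : ∀ {n} → Graph n → Fin n → Fin n → Set
Adj G i j = edge G i j ≡ true

Adj? : ∀ {n} (G : Graph n) i j → Dec (Adj G i j)
Adj? G i j = edge G i j BoolP.≟ true

degree : ∀ {n} → Graph n → Fin n → ℕ
degree {n} G v = length (filter (Adj? G v) (allFin n))

MinDegree : ∀ {n} → Graph n → ℕ → Set
MinDegree {n} G d = (∀ v → d ≤ degree G v) × (∃ λ v → degree G v ≡ d)

IsCliqueFor : ∀ {n} → (Fin n → Fin n → Set) → Subset n → Set
IsCliqueFor {n} R S = ∀ (i j : Fin n) → i ∈ S → j ∈ S → i ≢ j → R i j

HasKFor : ∀ {n} → (Fin n → Fin n → Set) → ℕ → Set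
HasKFor {n} R s = Σ (Subset n) λ S → ∣ S ∣ ≡ s × IsCliqueFor R S

AdjPlus : ∀ {n} → Graph n → Fin n → Fin n → Fin n → Fin n → Set
AdjPlus G u v i j = Adj G i j ⊎ ((i ≡ u × j ≡ v) ⊎ (i ≡ v × j ≡ u))

KSaturated : ∀ {n} → Graph n → ℕ → Set
KSaturated {n} G s =
  ¬ HasKFor (Adj G) s ×
  (∀ (u v : Fin n) → u ≢ v → ¬ Adj G u v → HasKFor (AdjPlus G u v) s)

allSubsets : ∀ n → List (Subset n)
allSubsets zero = [] ∷ []
allSubsets (suc n) = map (outside ∷_) (allSubsets n) ++ map (inside ∷_) (allSubsets n)

clique? : ∀ {n} (G : Graph n) (S : Subset n) → Dec (IsCliqueFor (Adj G) S)
clique? G S = FinP.all? λ i → FinP.all? λ j →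
  (i ∈? S) →-dec ((j ∈? S) →-dec (¬? (i FinP.≟ j) →-dec Adj? G i j))

numK : ∀ {n} → Graph n → ℕ → ℕ
numK {n} G r = length (filter (λ S → (∣ S ∣ ≟ r) ×-dec clique? G S) (allSubsets n))

_≅_ : ∀ {n} → Graph n → Graph n → Set
_≅_ {n} G H = Σ (Fin n ↔ Fin n) λ f →
  ∀ i j → edge G i j ≡ edge H (Inverse.to f i) (Inverse.to f j)

-- K_k + complement(K_{n-k}) on Fin n: vertices with index < k form the clique,
-- the rest an independent set, all clique–independent pairs adjacent.
joinEdge : ∀ {n} → ℕ → Fin n → Fin n → Bool
joinEdge k i j = not (does (i FinP.≟ j)) ∧ (does (toℕ i <? k) ∨ does (toℕ j <? k))

joinSym : ∀ {n} k (i j : Fin n) → joinEdge k i j ≡ joinEdge k j i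
joinSym k i j with i FinP.≟ j | j FinP.≟ i
... | yes _  | yes _  = refl
... | no _   | no _   = BoolP.∨-comm (does (toℕ i <? k)) (does (toℕ j <? k))
... | yes eq | no neq = ⊥-elim (neq (PE.sym eq))
... | no neq | yes eq = ⊥-elim (neq (PE.sym eq))

joinIrrefl : ∀ {n} k (i : Fin n) → joinEdge k i i ≡ false
joinIrrefl k i with i FinP.≟ i
... | yes _ = refl
... | no ne = ⊥-elim (ne refl)

joinGraph : ∀ n → ℕ → Graph n
joinGraph n k = record { edge = joinEdge k ; sym = joinSym k ; irrefl = joinIrrefl k }

module Submission where

-- Let v be a vertex of minimum degree s - 2 in a K_s-saturated graph G and
-- let N be its neighbourhood. For a non-neighbour u ≠ v, the K_s created by
-- adding uv contains u and v, and all its other vertices are neighbours of v;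
-- as |N ∪ {u, v}| ≤ s it is exactly N ∪ {u, v}. Hence N is a clique joined to
-- every non-neighbour (if v has no non-neighbour, G has only s - 1 vertices
-- and saturation makes it complete). Two adjacent non-neighbours would extend
-- N to a K_s, so the non-neighbours are independent: G is the join of the
-- clique N with an independent set.

open import Defs hiding (sym)
open import Data.Nat using (ℕ; zero; suc; _<_; _≤_; _+_; _*_; _∸_; z≤n; s≤s; _≡ᵇ_; _≤ᵇ_)
import Data.Nat.Properties as ℕₚ
open import Data.Nat.Combinatorics using (_C_; nC1≡n; nCk+nC[k+1]≡[n+1]C[k+1])
open import Data.Bool using (Bool; true; false; _∧_; _∨_; not)
import Data.Bool.Properties as Boolₚ
open import Data.Fin using (Fin; zero; suc; toℕ; fromℕ<)
import Data.Fin.Properties as Finₚ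
open import Data.Fin.Permutation as Perm
  using (Permutation; _⟨$⟩ʳ_; _⟨$⟩ˡ_; lift₀; transpose; _∘ₚ_; inverseˡ)
open import Data.Fin.Subset
  using (Subset; inside; outside; _∈_; _∉_; _⊆_; ∣_∣; ⁅_⁆; _∪_; _∩_; _─_; ∁; ⊤)
open import Data.Fin.Subset.Properties
  using (_∈?_; p⊆q⇒∣p∣≤∣q∣; p⊂q⇒∣p∣<∣q∣; p⊆p∪q; x∈p∪q⁺; x∈p∪q⁻; x∈⁅x⁆; x∈⁅y⁆⇒x≡y;
         ∣⁅x⁆∣≡1; x∈p∧x≢y⇒x∈p-y; x∈p⇒∣p-x∣<∣p∣; x∈p∧x∉q⇒x∈p─q; nonempty?; Empty-unique;
         ∣⊥∣≡0; drop-there; ∣p∣≤n; ∣⊤∣≡n; ∣∁p∣≡n∸∣p∣)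
open import Data.Vec using ([]; _∷_; here; there; tabulate)
import Data.Vec.Properties as Vecₚ
open import Data.List using (List; []; _∷_; map; _++_; length; filter)
import Data.List as List
import Data.List.Properties as Listₚ
open import Data.Product using (Σ; _×_; _,_; proj₁; proj₂)
open import Data.Sum using (_⊎_; inj₁; inj₂; [_,_])
open import Relation.Nullary using (¬_; yes; no; does; contradiction)
open import Relation.Nullary.Decidable using (_×-dec_; ¬?; dec-false; does-⇔; decidable-stable)
open import Relation.Unary using (Pred; Decidable)
open import Relation.Binary.PropositionalEquality hiding ([_])
open import Function using (_∘_)
open import Function.Bundles using (_⇔_; mk⇔)
import Algebra.Properties.CommutativeSemigroup as CommSemigroupₚ

∣p∪q∣≤∣p∣+∣q∣ : ∀ {n} (p q : Subset n) → ∣ p ∪ q ∣ ≤ ∣ p ∣ + ∣ q ∣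
∣p∪q∣≤∣p∣+∣q∣ []            []            = z≤n
∣p∪q∣≤∣p∣+∣q∣ (inside ∷ p)  (inside ∷ q)  =
  s≤s (ℕₚ.≤-trans (∣p∪q∣≤∣p∣+∣q∣ p q) (ℕₚ.+-monoʳ-≤ ∣ p ∣ (ℕₚ.n≤1+n ∣ q ∣)))
∣p∪q∣≤∣p∣+∣q∣ (inside ∷ p)  (outside ∷ q) = s≤s (∣p∪q∣≤∣p∣+∣q∣ p q)
∣p∪q∣≤∣p∣+∣q∣ (outside ∷ p) (inside ∷ q)  =
  subst (suc ∣ p ∪ q ∣ ≤_) (sym (ℕₚ.+-suc ∣ p ∣ ∣ q ∣)) (s≤s (∣p∪q∣≤∣p∣+∣q∣ p q))
∣p∪q∣≤∣p∣+∣q∣ (outside ∷ p) (outside ∷ q) = ∣p∪q∣≤∣p∣+∣q∣ p q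

∣p∪⁅x⁆∣≡1+∣p∣ : ∀ {n} {x : Fin n} (p : Subset n) → x ∉ p → ∣ p ∪ ⁅ x ⁆ ∣ ≡ suc ∣ p ∣
∣p∪⁅x⁆∣≡1+∣p∣ {x = x} p x∉p = ℕₚ.≤-antisym upper lower
  where
  upper : ∣ p ∪ ⁅ x ⁆ ∣ ≤ suc ∣ p ∣
  upper = ℕₚ.≤-trans (∣p∪q∣≤∣p∣+∣q∣ p ⁅ x ⁆)
            (ℕₚ.≤-reflexive (trans (cong (∣ p ∣ +_) (∣⁅x⁆∣≡1 x)) (ℕₚ.+-comm ∣ p ∣ 1)))
  lower : suc ∣ p ∣ ≤ ∣ p ∪ ⁅ x ⁆ ∣
  lower = p⊂q⇒∣p∣<∣q∣ (p⊆p∪q ⁅ x ⁆ , x , x∈p∪q⁺ (inj₂ (x∈⁅x⁆ x)) , x∉p)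

⊆-exhausts : ∀ {n} {p q : Subset n} → p ⊆ q → ∣ q ∣ ≤ ∣ p ∣ → q ⊆ p
⊆-exhausts {p = p} {q} p⊆q ∣q∣≤∣p∣ {x} x∈q with x ∈? p
... | yes x∈p = x∈p
... | no  x∉p = contradiction (p⊂q⇒∣p∣<∣q∣ (p⊆q , x , x∈q , x∉p)) (ℕₚ.≤⇒≯ ∣q∣≤∣p∣)

∈⇒1≤∣p∣ : ∀ {n} {x : Fin n} {p : Subset n} → x ∈ p → 1 ≤ ∣ p ∣
∈⇒1≤∣p∣ {x = x} x∈p = subst (_≤ _) (∣⁅x⁆∣≡1 x)
  (p⊆q⇒∣p∣≤∣q∣ λ y∈⁅x⁆ → subst (_∈ _) (sym (x∈⁅y⁆⇒x≡y x y∈⁅x⁆)) x∈p)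

∣p∣≤1⇒unique : ∀ {n} {x y : Fin n} {p : Subset n} → ∣ p ∣ ≤ 1 → x ∈ p → y ∈ p → x ≡ y
∣p∣≤1⇒unique {x = x} {y} ∣p∣≤1 x∈p y∈p with y Finₚ.≟ x
... | yes y≡x = sym y≡x
... | no  y≢x = contradiction ∣p∣≤1 (ℕₚ.<⇒≱ (ℕₚ.≤-trans (s≤s (∈⇒1≤∣p∣ (x∈p∧x≢y⇒x∈p-y y∈p y≢x)))
                                                           (x∈p⇒∣p-x∣<∣p∣ x∈p)))

unique⇒∣p∣≤1 : ∀ {n} (p : Subset n) → (∀ {x y} → x ∈ p → y ∈ p → x ≡ y) → ∣ p ∣ ≤ 1
unique⇒∣p∣≤1 {n} p unique with nonempty? p
... | yes (x , x∈p) = subst (_ ≤_) (∣⁅x⁆∣≡1 x)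
        (p⊆q⇒∣p∣≤∣q∣ λ y∈p → subst (_∈ ⁅ x ⁆) (unique x∈p y∈p) (x∈⁅x⁆ x))
... | no  empty     = ℕₚ.≤-trans (ℕₚ.≤-reflexive (trans (cong ∣_∣ (Empty-unique empty)) (∣⊥∣≡0 n))) z≤n

∈─⁻ : ∀ {n} {x : Fin n} (p q : Subset n) → x ∈ p ─ q → x ∈ p × x ∉ q
∈─⁻ (b ∷ p) (inside ∷ q)  (there x∈) = let x∈p , x∉q = ∈─⁻ p q x∈ in there x∈p , x∉q ∘ drop-there
∈─⁻ (b ∷ p) (outside ∷ q) here       = here , λ ()
∈─⁻ (b ∷ p) (outside ∷ q) (there x∈) = let x∈p , x∉q = ∈─⁻ p q x∈ in there x∈p , x∉q ∘ drop-there

indicator : Bool → ℕ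
indicator true  = 1
indicator false = 0

sumSubsets : ∀ {n} → (Subset n → ℕ) → ℕ
sumSubsets {zero}  f = f []
sumSubsets {suc n} f = sumSubsets (λ S → f (outside ∷ S)) + sumSubsets (λ S → f (inside ∷ S))

sum-cong : ∀ {n} {f g : Subset n → ℕ} → (∀ S → f S ≡ g S) → sumSubsets f ≡ sumSubsets g
sum-cong {zero}  f≗g = f≗g []
sum-cong {suc n} f≗g = cong₂ _+_ (sum-cong (f≗g ∘ (outside ∷_))) (sum-cong (f≗g ∘ (inside ∷_)))

sum-zero : ∀ {n} → sumSubsets {n} (λ _ → 0) ≡ 0
sum-zero {zero}  = refl
sum-zero {suc n} = cong₂ _+_ (sum-zero {n}) (sum-zero {n})

sum-+ : ∀ {n} (f g : Subset n → ℕ) →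
  sumSubsets (λ S → f S + g S) ≡ sumSubsets f + sumSubsets g
sum-+ {zero}  f g = refl
sum-+ {suc n} f g = trans
  (cong₂ _+_ (sum-+ (f ∘ (outside ∷_)) (g ∘ (outside ∷_))) (sum-+ (f ∘ (inside ∷_)) (g ∘ (inside ∷_))))
  (interchange (sumSubsets (f ∘ (outside ∷_))) _ _ _)
  where open CommSemigroupₚ ℕₚ.+-commutativeSemigroup using (interchange)

length-filter-map : ∀ {a b p} {A : Set a} {B : Set b} {P : Pred B p} (P? : Decidable P)
  (f : A → B) (xs : List A) → length (filter P? (map f xs)) ≡ length (filter (P? ∘ f) xs)
length-filter-map P? f []       = refl
length-filter-map P? f (x ∷ xs) with does (P? (f x))
... | true  = cong suc (length-filter-map P? f xs)
... | false = length-filter-map P? f xs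

length-filter-allSubsets : ∀ {n p} {P : Pred (Subset n) p} (P? : Decidable P) →
  length (filter P? (allSubsets n)) ≡ sumSubsets (λ S → indicator (does (P? S)))
length-filter-allSubsets {zero} P? with does (P? [])
... | true  = refl
... | false = refl
length-filter-allSubsets {suc n} P? = begin
  length (filter P? (map (outside ∷_) A ++ map (inside ∷_) A))
    ≡⟨ cong length (Listₚ.filter-++ P? (map (outside ∷_) A) (map (inside ∷_) A)) ⟩
  length (filter P? (map (outside ∷_) A) ++ filter P? (map (inside ∷_) A))
    ≡⟨ Listₚ.length-++ (filter P? (map (outside ∷_) A)) ⟩
  length (filter P? (map (outside ∷_) A)) + length (filter P? (map (inside ∷_) A))
    ≡⟨ cong₂ _+_ (length-filter-map P? _ A) (length-filter-map P? _ A) ⟩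
  length (filter (P? ∘ (outside ∷_)) A) + length (filter (P? ∘ (inside ∷_)) A)
    ≡⟨ cong₂ _+_ (length-filter-allSubsets (P? ∘ (outside ∷_))) (length-filter-allSubsets (P? ∘ (inside ∷_))) ⟩
  sumSubsets (λ S → indicator (does (P? S))) ∎
  where
  open ≡-Reasoning
  A = allSubsets n

∣p∣≡∣p∩q∣+∣p─q∣ : ∀ {n} (p q : Subset n) → ∣ p ∣ ≡ ∣ p ∩ q ∣ + ∣ p ─ q ∣
∣p∣≡∣p∩q∣+∣p─q∣ []            []            = refl
∣p∣≡∣p∩q∣+∣p─q∣ (inside ∷ p)  (inside ∷ q)  = cong suc (∣p∣≡∣p∩q∣+∣p─q∣ p q)
∣p∣≡∣p∩q∣+∣p─q∣ (inside ∷ p)  (outside ∷ q) =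
  trans (cong suc (∣p∣≡∣p∩q∣+∣p─q∣ p q)) (sym (ℕₚ.+-suc ∣ p ∩ q ∣ ∣ p ─ q ∣))
∣p∣≡∣p∩q∣+∣p─q∣ (outside ∷ p) (inside ∷ q)  = ∣p∣≡∣p∩q∣+∣p─q∣ p q
∣p∣≡∣p∩q∣+∣p─q∣ (outside ∷ p) (outside ∷ q) = ∣p∣≡∣p∩q∣+∣p─q∣ p q

count-by-trace : ∀ {n} (H : Subset n) a b →
  sumSubsets (λ S → indicator ((∣ S ∩ H ∣ ≡ᵇ a) ∧ (∣ S ─ H ∣ ≡ᵇ b))) ≡ (∣ H ∣ C a) * (∣ ∁ H ∣ C b)
count-by-trace []            zero    zero    = refl
count-by-trace []            zero    (suc b) = refl
count-by-trace []            (suc a) b       = refl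
count-by-trace {suc n} (inside ∷ H) zero b =
  trans (cong₂ _+_ (count-by-trace H zero b) (sum-zero {n})) (ℕₚ.+-identityʳ _)
count-by-trace (inside ∷ H)  (suc a) b       = begin
  _                               ≡⟨ cong₂ _+_ (count-by-trace H (suc a) b) (count-by-trace H a b) ⟩
  (k C suc a) * M + (k C a) * M   ≡⟨ ℕₚ.*-distribʳ-+ M (k C suc a) (k C a) ⟨
  (k C suc a + k C a) * M         ≡⟨ cong (_* M) pascal ⟩
  (suc k C suc a) * M             ∎
  where
  open ≡-Reasoning
  k = ∣ H ∣
  M = ∣ ∁ H ∣ C b
  pascal : k C suc a + k C a ≡ suc k C suc a
  pascal = trans (ℕₚ.+-comm (k C suc a) (k C a)) (nCk+nC[k+1]≡[n+1]C[k+1] k a)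
count-by-trace {suc n} (outside ∷ H) a zero =
  trans (cong₂ _+_ (count-by-trace H a zero) none-outside) (ℕₚ.+-identityʳ _)
  where
  none-outside : sumSubsets (λ S → indicator ((∣ S ∩ H ∣ ≡ᵇ a) ∧ false)) ≡ 0
  none-outside = trans (sum-cong λ S → cong indicator (Boolₚ.∧-zeroʳ (∣ S ∩ H ∣ ≡ᵇ a))) (sum-zero {n})
count-by-trace (outside ∷ H) a       (suc b) = begin
  _                               ≡⟨ cong₂ _+_ (count-by-trace H a (suc b)) (count-by-trace H a b) ⟩
  K * (m C suc b) + K * (m C b)   ≡⟨ ℕₚ.*-distribˡ-+ K (m C suc b) (m C b) ⟨
  K * (m C suc b + m C b)         ≡⟨ cong (K *_) pascal ⟩
  K * (suc m C suc b)             ∎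
  where
  open ≡-Reasoning
  K = ∣ H ∣ C a
  m = ∣ ∁ H ∣
  pascal : m C suc b + m C b ≡ suc m C suc b
  pascal = trans (ℕₚ.+-comm (m C suc b) (m C b)) (nCk+nC[k+1]≡[n+1]C[k+1] m b)

at-most-one-outside : ∀ a b r → indicator ((a + b ≡ᵇ suc r) ∧ (b ≤ᵇ 1)) ≡
  indicator ((a ≡ᵇ suc r) ∧ (b ≡ᵇ 0)) + indicator ((a ≡ᵇ r) ∧ (b ≡ᵇ 1))
at-most-one-outside a zero r
  rewrite ℕₚ.+-identityʳ a | Boolₚ.∧-identityʳ (a ≡ᵇ suc r) | Boolₚ.∧-zeroʳ (a ≡ᵇ r) =
  sym (ℕₚ.+-identityʳ _)
at-most-one-outside a (suc zero) r
  rewrite ℕₚ.+-comm a 1 | Boolₚ.∧-zeroʳ (a ≡ᵇ suc r) | Boolₚ.∧-identityʳ (a ≡ᵇ r) = refl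
at-most-one-outside a (suc (suc b)) r
  rewrite Boolₚ.∧-zeroʳ (a + suc (suc b) ≡ᵇ suc r) | Boolₚ.∧-zeroʳ (a ≡ᵇ suc r)
        | Boolₚ.∧-zeroʳ (a ≡ᵇ r) = refl

count-nearly-inside : ∀ {n} (H : Subset n) r →
  sumSubsets (λ S → indicator ((∣ S ∣ ≡ᵇ suc r) ∧ (∣ S ─ H ∣ ≤ᵇ 1))) ≡
  ∣ H ∣ C suc r + ∣ ∁ H ∣ * (∣ H ∣ C r)
count-nearly-inside H r = begin
  sumSubsets (λ S → indicator ((∣ S ∣ ≡ᵇ suc r) ∧ (∣ S ─ H ∣ ≤ᵇ 1)))
    ≡⟨ sum-cong split ⟩
  sumSubsets (λ S → inside-only S + one-outside S)
    ≡⟨ sum-+ inside-only one-outside ⟩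
  sumSubsets inside-only + sumSubsets one-outside
    ≡⟨ cong₂ _+_ (count-by-trace H (suc r) 0) (count-by-trace H r 1) ⟩
  (∣ H ∣ C suc r) * 1 + (∣ H ∣ C r) * (∣ ∁ H ∣ C 1)
    ≡⟨ cong₂ _+_ (ℕₚ.*-identityʳ _) (trans (cong ((∣ H ∣ C r) *_) (nC1≡n ∣ ∁ H ∣))
                                           (ℕₚ.*-comm (∣ H ∣ C r) ∣ ∁ H ∣)) ⟩
  ∣ H ∣ C suc r + ∣ ∁ H ∣ * (∣ H ∣ C r) ∎
  where
  open ≡-Reasoning
  inside-only one-outside : Subset _ → ℕ
  inside-only S = indicator ((∣ S ∩ H ∣ ≡ᵇ suc r) ∧ (∣ S ─ H ∣ ≡ᵇ 0))
  one-outside S = indicator ((∣ S ∩ H ∣ ≡ᵇ r) ∧ (∣ S ─ H ∣ ≡ᵇ 1))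
  split : ∀ S → indicator ((∣ S ∣ ≡ᵇ suc r) ∧ (∣ S ─ H ∣ ≤ᵇ 1)) ≡ inside-only S + one-outside S
  split S = trans (cong (λ m → indicator ((m ≡ᵇ suc r) ∧ (∣ S ─ H ∣ ≤ᵇ 1))) (∣p∣≡∣p∩q∣+∣p─q∣ S H))
                  (at-most-one-outside ∣ S ∩ H ∣ ∣ S ─ H ∣ r)

adj-sym : ∀ {n} (G : Graph n) {i j} → Adj G i j → Adj G j i
adj-sym G {i} {j} i~j = trans (Graph.sym G j i) i~j

adj⇒≢ : ∀ {n} (G : Graph n) {i j} → Adj G i j → i ≢ j
adj⇒≢ G {i} i~i refl with () ← trans (sym i~i) (irrefl G i)

nbhd : ∀ {n} → Graph n → Fin n → Subset n
nbhd G v = tabulate (edge G v)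

∈nbhd⁺ : ∀ {n} (G : Graph n) {v i} → Adj G v i → i ∈ nbhd G v
∈nbhd⁺ G {v} {i} v~i = Vecₚ.lookup⇒[]= i (nbhd G v) (trans (Vecₚ.lookup∘tabulate (edge G v) i) v~i)

∈nbhd⁻ : ∀ {n} (G : Graph n) {v i} → i ∈ nbhd G v → Adj G v i
∈nbhd⁻ G {v} {i} i∈N = trans (sym (Vecₚ.lookup∘tabulate (edge G v) i)) (Vecₚ.[]=⇒lookup i∈N)

length-filter-tabulate : ∀ {a p} {A : Set a} {P : Pred A p} (P? : Decidable P) {n} (f : Fin n → A) →
  length (filter P? (List.tabulate f)) ≡ ∣ tabulate (λ i → does (P? (f i))) ∣
length-filter-tabulate P? {zero}  f = refl
length-filter-tabulate P? {suc n} f with does (P? (f zero))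
... | true  = cong suc (length-filter-tabulate P? (λ i → f (suc i)))
... | false = length-filter-tabulate P? (λ i → f (suc i))

degree≡∣nbhd∣ : ∀ {n} (G : Graph n) v → degree G v ≡ ∣ nbhd G v ∣
degree≡∣nbhd∣ G v = trans (length-filter-tabulate (Adj? G v) (λ i → i))
                          (cong ∣_∣ (Vecₚ.tabulate-cong λ i → does-≟true (edge G v i)))
  where
  does-≟true : ∀ b → does (b Boolₚ.≟ true) ≡ b
  does-≟true true  = refl
  does-≟true false = refl

record IsJoin {n} (G : Graph n) (H : Subset n) : Set where
  field
    hub-clique      : ∀ {i j} → i ∈ H → j ∈ H → i ≢ j → Adj G i j
    hub-to-rim      : ∀ {i j} → i ∈ H → j ∉ H → Adj G i j
    rim-independent : ∀ {i j} → i ∉ H → j ∉ H → ¬ Adj G i j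

module _ {n} {G : Graph n} {H : Subset n} (J : IsJoin G H) where
  open IsJoin J

  join-edge : ∀ i j → edge G i j ≡ not (does (i Finₚ.≟ j)) ∧ (does (i ∈? H) ∨ does (j ∈? H))
  join-edge i j with i Finₚ.≟ j | i ∈? H | j ∈? H
  ... | yes refl | _       | _       = irrefl G i
  ... | no  i≢j  | yes i∈H | yes j∈H = hub-clique i∈H j∈H i≢j
  ... | no  i≢j  | yes i∈H | no  j∉H = hub-to-rim i∈H j∉H
  ... | no  i≢j  | no  i∉H | yes j∈H = adj-sym G (hub-to-rim j∈H i∉H)
  ... | no  i≢j  | no  i∉H | no  j∉H = Boolₚ.¬-not (rim-independent i∉H j∉H)

  join-clique⇔ : ∀ S → IsCliqueFor (Adj G) S ⇔ ∣ S ─ H ∣ ≤ 1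
  join-clique⇔ S = mk⇔ to from
    where
    to : IsCliqueFor (Adj G) S → ∣ S ─ H ∣ ≤ 1
    to clique = unique⇒∣p∣≤1 (S ─ H) off-hub-equal
      where
      off-hub-equal : ∀ {x y} → x ∈ S ─ H → y ∈ S ─ H → x ≡ y
      off-hub-equal {x} {y} x∈ y∈ with x Finₚ.≟ y | ∈─⁻ S H x∈ | ∈─⁻ S H y∈
      ... | yes x≡y | _ | _ = x≡y
      ... | no  x≢y | x∈S , x∉H | y∈S , y∉H = contradiction (clique x y x∈S y∈S x≢y) (rim-independent x∉H y∉H)
    from : ∣ S ─ H ∣ ≤ 1 → IsCliqueFor (Adj G) S
    from ≤1 i j i∈S j∈S i≢j with i ∈? H | j ∈? H
    ... | yes i∈H | yes j∈H = hub-clique i∈H j∈H i≢j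
    ... | yes i∈H | no  j∉H = hub-to-rim i∈H j∉H
    ... | no  i∉H | yes j∈H = adj-sym G (hub-to-rim j∈H i∉H)
    ... | no  i∉H | no  j∉H =
      contradiction (∣p∣≤1⇒unique ≤1 (x∈p∧x∉q⇒x∈p─q i∈S i∉H) (x∈p∧x∉q⇒x∈p─q j∈S j∉H)) i≢j

  numK-join : ∀ r → numK G (suc r) ≡ ∣ H ∣ C suc r + ∣ ∁ H ∣ * (∣ H ∣ C r)
  numK-join r = begin
    numK G (suc r)
      ≡⟨ length-filter-allSubsets (λ S → (∣ S ∣ ℕₚ.≟ suc r) ×-dec clique? G S) ⟩
    sumSubsets (λ S → indicator ((∣ S ∣ ≡ᵇ suc r) ∧ does (clique? G S)))
      ≡⟨ sum-cong (λ S → cong (λ b → indicator ((∣ S ∣ ≡ᵇ suc r) ∧ b))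
                            (does-⇔ (join-clique⇔ S) (clique? G S) (∣ S ─ H ∣ ℕₚ.≤? 1))) ⟩
    sumSubsets (λ S → indicator ((∣ S ∣ ≡ᵇ suc r) ∧ (∣ S ─ H ∣ ≤ᵇ 1)))
      ≡⟨ count-nearly-inside H r ⟩
    ∣ H ∣ C suc r + ∣ ∁ H ∣ * (∣ H ∣ C r) ∎
    where open ≡-Reasoning

toFront : ∀ {n} (H : Subset n) →
  Σ (Permutation n n) λ π → ∀ x → does (x ∈? H) ≡ does (toℕ (π ⟨$⟩ʳ x) ℕₚ.<? ∣ H ∣)
toFront []            = Perm.id , λ ()
toFront (inside ∷ H)  with π , spec ← toFront H = lift₀ π , λ { zero → refl ; (suc x) → spec x }
toFront {suc n} (outside ∷ H) with π , spec ← toFront H = lift₀ π ∘ₚ transpose zero K , moved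
  where
  -- the vertex zero is outside H: swap it with position |H|, the first slot
  -- after the image of H under π
  k = ∣ H ∣
  K : Fin (suc n)
  K = fromℕ< (s≤s (∣p∣≤n H))
  toℕK : toℕ K ≡ k
  toℕK = Finₚ.toℕ-fromℕ< (s≤s (∣p∣≤n H))
  moved : ∀ x → does (x ∈? (outside ∷ H)) ≡
                does (toℕ ((lift₀ π ∘ₚ transpose zero K) ⟨$⟩ʳ x) ℕₚ.<? k)
  moved zero = sym (dec-false (toℕ K ℕₚ.<? k) (subst (λ m → ¬ m < k) (sym toℕK) (ℕₚ.n≮n k)))
  moved (suc x) with suc (π ⟨$⟩ʳ x) Finₚ.≟ K
  ... | yes x↦K = trans (spec x) (does-⇔ (mk⇔ (λ _ → 0<k) (λ _ → x<k)) (_ ℕₚ.<? k) (0 ℕₚ.<? k))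
    where
    1+x≡k : suc (toℕ (π ⟨$⟩ʳ x)) ≡ k
    1+x≡k = trans (cong toℕ x↦K) toℕK
    x<k : toℕ (π ⟨$⟩ʳ x) < k
    x<k = ℕₚ.≤-reflexive 1+x≡k
    0<k : 0 < k
    0<k = ℕₚ.≤-trans (s≤s z≤n) x<k
  ... | no  x↦̸K = trans (spec x) (does-⇔ (mk⇔ step-up step-down) (_ ℕₚ.<? k) (_ ℕₚ.<? k))
    where
    step-up : toℕ (π ⟨$⟩ʳ x) < k → suc (toℕ (π ⟨$⟩ʳ x)) < k
    step-up x<k = ℕₚ.≤∧≢⇒< x<k λ 1+x≡k → x↦̸K (Finₚ.toℕ-injective (trans 1+x≡k (sym toℕK)))
    step-down : suc (toℕ (π ⟨$⟩ʳ x)) < k → toℕ (π ⟨$⟩ʳ x) < k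
    step-down = ℕₚ.<-trans (ℕₚ.n<1+n _)

join-≅ : ∀ {n} {G : Graph n} {H : Subset n} → IsJoin G H → G ≅ joinGraph n ∣ H ∣
join-≅ {n} {G} {H} J with π , spec ← toFront H = π , preserves
  where
  π-injective : ∀ {i j} → π ⟨$⟩ʳ i ≡ π ⟨$⟩ʳ j → i ≡ j
  π-injective e = trans (sym (inverseˡ π)) (trans (cong (π ⟨$⟩ˡ_) e) (inverseˡ π))
  preserves : ∀ i j → edge G i j ≡ joinEdge ∣ H ∣ (π ⟨$⟩ʳ i) (π ⟨$⟩ʳ j)
  preserves i j = trans (join-edge J i j)
    (cong₂ (λ a b → not a ∧ b) (does-⇔ (mk⇔ (cong (π ⟨$⟩ʳ_)) π-injective) (i Finₚ.≟ j) (π ⟨$⟩ʳ i Finₚ.≟ π ⟨$⟩ʳ j))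
                               (cong₂ _∨_ (spec i) (spec j)))

module _ {n} (G : Graph n) {u v : Fin n} where

  clique-missing-end : ∀ {S} → IsCliqueFor (AdjPlus G u v) S → u ∉ S ⊎ v ∉ S → IsCliqueFor (Adj G) S
  clique-missing-end clique missing i j i∈S j∈S i≢j with clique i j i∈S j∈S i≢j
  ... | inj₁ i~j                  = i~j
  ... | inj₂ (inj₁ (refl , refl)) = [ contradiction i∈S , contradiction j∈S ] missing
  ... | inj₂ (inj₂ (refl , refl)) = [ contradiction j∈S , contradiction i∈S ] missing

  old-edge : ∀ {i j} → AdjPlus G u v i j → j ≢ u → j ≢ v → Adj G i j
  old-edge (inj₁ i~j)               _   _   = i~j
  old-edge (inj₂ (inj₁ (_ , j≡v))) _   j≢v = contradiction j≡v j≢v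
  old-edge (inj₂ (inj₂ (_ , j≡u))) j≢u _   = contradiction j≡u j≢u

  saturating-clique : ∀ {s} → KSaturated G s → u ≢ v → ¬ Adj G u v →
    Σ (Subset n) λ S → ∣ S ∣ ≡ s × IsCliqueFor (AdjPlus G u v) S × u ∈ S × v ∈ S
  saturating-clique (K-free , saturated) u≢v u≁v
    with S , ∣S∣≡s , clique ← saturated u v u≢v u≁v | u ∈? S | v ∈? S
  ... | yes u∈S | yes v∈S = S , ∣S∣≡s , clique , u∈S , v∈S
  ... | no  u∉S | _       = contradiction (S , ∣S∣≡s , clique-missing-end clique (inj₁ u∉S)) K-free
  ... | yes _   | no  v∉S = contradiction (S , ∣S∣≡s , clique-missing-end clique (inj₂ v∉S)) K-free

module LowDegreeVertex {n} {G : Graph n} {s} (sat : KSaturated G s) (v : Fin n)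
                       (s≡2+deg : s ≡ 2 + ∣ nbhd G v ∣) where

  N : Subset n
  N = nbhd G v

  v∉N : v ∉ N
  v∉N v∈N = adj⇒≢ G (∈nbhd⁻ G v∈N) refl

  -- For a non-neighbour u ≠ v, the K_s created by adding uv lies inside
  -- N ∪ {u, v}, which has at most s vertices; so it is all of N ∪ {u, v}.
  module NonNeighbour (u : Fin n) (u≢v : u ≢ v) (u∉N : u ∉ N) where

    u≁v : ¬ Adj G u v
    u≁v = u∉N ∘ ∈nbhd⁺ G ∘ adj-sym G

    S : Subset n
    S = proj₁ (saturating-clique G sat u≢v u≁v)

    ∣S∣≡s : ∣ S ∣ ≡ s
    ∣S∣≡s = proj₁ (proj₂ (saturating-clique G sat u≢v u≁v))

    S-clique : IsCliqueFor (AdjPlus G u v) S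
    S-clique = proj₁ (proj₂ (proj₂ (saturating-clique G sat u≢v u≁v)))

    u∈S : u ∈ S
    u∈S = proj₁ (proj₂ (proj₂ (proj₂ (saturating-clique G sat u≢v u≁v))))

    v∈S : v ∈ S
    v∈S = proj₂ (proj₂ (proj₂ (proj₂ (saturating-clique G sat u≢v u≁v))))

    -- every other vertex of S is joined to v by an old edge, so lies in N
    S⊆N∪uv : S ⊆ N ∪ ⁅ u ⁆ ∪ ⁅ v ⁆
    S⊆N∪uv {w} w∈S with w Finₚ.≟ u | w Finₚ.≟ v
    ... | yes refl | _        = x∈p∪q⁺ (inj₂ (x∈p∪q⁺ (inj₁ (x∈⁅x⁆ w))))
    ... | no  _    | yes refl = x∈p∪q⁺ (inj₂ (x∈p∪q⁺ (inj₂ (x∈⁅x⁆ w))))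
    ... | no  w≢u  | no  w≢v  =
      x∈p∪q⁺ (inj₁ (∈nbhd⁺ G (old-edge G (S-clique v w v∈S w∈S (w≢v ∘ sym)) w≢u w≢v)))

    ∣N∪uv∣≤s : ∣ N ∪ ⁅ u ⁆ ∪ ⁅ v ⁆ ∣ ≤ s
    ∣N∪uv∣≤s = begin
      ∣ N ∪ ⁅ u ⁆ ∪ ⁅ v ⁆ ∣           ≤⟨ ∣p∪q∣≤∣p∣+∣q∣ N (⁅ u ⁆ ∪ ⁅ v ⁆) ⟩
      ∣ N ∣ + ∣ ⁅ u ⁆ ∪ ⁅ v ⁆ ∣       ≤⟨ ℕₚ.+-monoʳ-≤ ∣ N ∣ (∣p∪q∣≤∣p∣+∣q∣ ⁅ u ⁆ ⁅ v ⁆) ⟩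
      ∣ N ∣ + (∣ ⁅ u ⁆ ∣ + ∣ ⁅ v ⁆ ∣) ≡⟨ cong (∣ N ∣ +_) (cong₂ _+_ (∣⁅x⁆∣≡1 u) (∣⁅x⁆∣≡1 v)) ⟩
      ∣ N ∣ + 2                       ≡⟨ ℕₚ.+-comm ∣ N ∣ 2 ⟩
      2 + ∣ N ∣                       ≡⟨ s≡2+deg ⟨
      s                               ∎
      where open ℕₚ.≤-Reasoning

    N⊆S : N ⊆ S
    N⊆S x∈N = ⊆-exhausts S⊆N∪uv (subst (_ ≤_) (sym ∣S∣≡s) ∣N∪uv∣≤s) (x∈p∪q⁺ (inj₁ x∈N))

    ∈N⇒≢u : ∀ {x} → x ∈ N → x ≢ u
    ∈N⇒≢u x∈N refl = u∉N x∈N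

    ∈N⇒≢v : ∀ {x} → x ∈ N → x ≢ v
    ∈N⇒≢v x∈N refl = v∉N x∈N

    N-clique : IsCliqueFor (Adj G) N
    N-clique x y x∈N y∈N x≢y =
      old-edge G (S-clique x y (N⊆S x∈N) (N⊆S y∈N) x≢y) (∈N⇒≢u y∈N) (∈N⇒≢v y∈N)

    u-to-N : ∀ {x} → x ∈ N → Adj G u x
    u-to-N x∈N =
      old-edge G (S-clique _ _ u∈S (N⊆S x∈N) (∈N⇒≢u x∈N ∘ sym)) (∈N⇒≢u x∈N) (∈N⇒≢v x∈N)

  -- If v is adjacent to all other vertices then n ≤ s - 1, so G + xy can
  -- never contain a K_s and saturation forces G to be complete.
  complete-if-dominating : (∀ u → u ≢ v → u ∈ N) → ∀ {x y} → x ≢ y → Adj G x y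
  complete-if-dominating dominating {x} {y} x≢y with Adj? G x y
  ... | yes x~y = x~y
  ... | no  x≁y with S , ∣S∣≡s , _ ← proj₂ sat x y x≢y x≁y =
    contradiction (ℕₚ.≤-trans (ℕₚ.≤-reflexive (sym ∣S∣≡s)) (∣p∣≤n S)) (ℕₚ.<⇒≱ n<s)
    where
    ⊤⊆N∪v : ⊤ ⊆ N ∪ ⁅ v ⁆
    ⊤⊆N∪v {w} _ with w Finₚ.≟ v
    ... | yes refl = x∈p∪q⁺ (inj₂ (x∈⁅x⁆ w))
    ... | no  w≢v  = x∈p∪q⁺ (inj₁ (dominating w w≢v))
    n<s : n < s
    n<s = begin-strict
      n                     ≡⟨ ∣⊤∣≡n n ⟨
      ∣ ⊤ {n} ∣             ≤⟨ p⊆q⇒∣p∣≤∣q∣ ⊤⊆N∪v ⟩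
      ∣ N ∪ ⁅ v ⁆ ∣         ≤⟨ ∣p∪q∣≤∣p∣+∣q∣ N ⁅ v ⁆ ⟩
      ∣ N ∣ + ∣ ⁅ v ⁆ ∣     ≡⟨ trans (cong (∣ N ∣ +_) (∣⁅x⁆∣≡1 v)) (ℕₚ.+-comm ∣ N ∣ 1) ⟩
      1 + ∣ N ∣             <⟨ ℕₚ.n<1+n _ ⟩
      2 + ∣ N ∣             ≡⟨ s≡2+deg ⟨
      s                     ∎
      where open ℕₚ.≤-Reasoning

  N-clique : IsCliqueFor (Adj G) N
  N-clique with Finₚ.any? (λ u → ¬? (u Finₚ.≟ v) ×-dec ¬? (u ∈? N))
  ... | yes (u , u≢v , u∉N) = NonNeighbour.N-clique u u≢v u∉N
  ... | no  no-non-neighbour = λ _ _ _ _ → complete-if-dominating dominating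
    where
    dominating : ∀ u → u ≢ v → u ∈ N
    dominating u u≢v = decidable-stable (u ∈? N) λ u∉N → no-non-neighbour (u , u≢v , u∉N)

  N-to-rim : ∀ {x w} → x ∈ N → w ∉ N → Adj G x w
  N-to-rim {w = w} x∈N w∉N with w Finₚ.≟ v
  ... | yes refl = adj-sym G (∈nbhd⁻ G x∈N)
  ... | no  w≢v  = adj-sym G (NonNeighbour.u-to-N w w≢v w∉N x∈N)

  -- Two adjacent non-neighbours w₁, w₂ would complete N to a K_s.
  rim-independent : ∀ {w₁ w₂} → w₁ ∉ N → w₂ ∉ N → ¬ Adj G w₁ w₂
  rim-independent {w₁} {w₂} w₁∉N w₂∉N w₁~w₂ = proj₁ sat (T , ∣T∣≡s , T-clique)
    where
    T : Subset n
    T = (N ∪ ⁅ w₁ ⁆) ∪ ⁅ w₂ ⁆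
    w₂∉N∪w₁ : w₂ ∉ N ∪ ⁅ w₁ ⁆
    w₂∉N∪w₁ w₂∈ = [ w₂∉N , adj⇒≢ G w₁~w₂ ∘ sym ∘ x∈⁅y⁆⇒x≡y w₁ ] (x∈p∪q⁻ N ⁅ w₁ ⁆ w₂∈)
    ∣T∣≡s : ∣ T ∣ ≡ s
    ∣T∣≡s = trans (∣p∪⁅x⁆∣≡1+∣p∣ (N ∪ ⁅ w₁ ⁆) w₂∉N∪w₁)
                  (trans (cong suc (∣p∪⁅x⁆∣≡1+∣p∣ N w₁∉N)) (sym s≡2+deg))
    IsRim : Fin n → Set
    IsRim x = x ≡ w₁ ⊎ x ≡ w₂
    classify : ∀ {x} → x ∈ T → x ∈ N ⊎ IsRim x
    classify {x} x∈T with x∈p∪q⁻ (N ∪ ⁅ w₁ ⁆) ⁅ w₂ ⁆ x∈T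
    ... | inj₂ x∈w₂ = inj₂ (inj₂ (x∈⁅y⁆⇒x≡y w₂ x∈w₂))
    ... | inj₁ x∈N∪w₁ with x∈p∪q⁻ N ⁅ w₁ ⁆ x∈N∪w₁
    ...   | inj₁ x∈N  = inj₁ x∈N
    ...   | inj₂ x∈w₁ = inj₂ (inj₁ (x∈⁅y⁆⇒x≡y w₁ x∈w₁))
    rim∉N : ∀ {x} → IsRim x → x ∉ N
    rim∉N (inj₁ refl) = w₁∉N
    rim∉N (inj₂ refl) = w₂∉N
    rim-pair : ∀ {x y} → IsRim x → IsRim y → x ≢ y → Adj G x y
    rim-pair (inj₁ refl) (inj₁ refl) x≢y = contradiction refl x≢y
    rim-pair (inj₁ refl) (inj₂ refl) _   = w₁~w₂
    rim-pair (inj₂ refl) (inj₁ refl) _   = adj-sym G w₁~w₂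
    rim-pair (inj₂ refl) (inj₂ refl) x≢y = contradiction refl x≢y
    T-clique : IsCliqueFor (Adj G) T
    T-clique x y x∈T y∈T x≢y with classify x∈T | classify y∈T
    ... | inj₁ x∈N   | inj₁ y∈N   = N-clique x y x∈N y∈N x≢y
    ... | inj₁ x∈N   | inj₂ y-rim = N-to-rim x∈N (rim∉N y-rim)
    ... | inj₂ x-rim | inj₁ y∈N   = adj-sym G (N-to-rim y∈N (rim∉N x-rim))
    ... | inj₂ x-rim | inj₂ y-rim = rim-pair x-rim y-rim x≢y

  join : IsJoin G N
  join = record
    { hub-clique      = λ {i} {j} → N-clique i j
    ; hub-to-rim      = N-to-rim
    ; rim-independent = rim-independent
    }

proposition1 : ∀ (r s n : ℕ) → 2 ≤ r → r < s → (G : Graph n) →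
    KSaturated G s → MinDegree G (s ∸ 2) →
    (G ≅ joinGraph n (s ∸ 2)) ×
    (numK G r ≡ (s ∸ 2) C r + (n ∸ (s ∸ 2)) * ((s ∸ 2) C (r ∸ 1)))
proposition1 zero    s n () r<s G sat min-degree
proposition1 (suc r) s n 2≤r r<s G sat (_ , v , deg-v≡s-2) =
  subst (λ k → G ≅ joinGraph n k) ∣N∣≡s-2 (join-≅ join) ,
  (begin
    numK G (suc r)                             ≡⟨ numK-join join r ⟩
    ∣ N ∣ C suc r + ∣ ∁ N ∣ * (∣ N ∣ C r)       ≡⟨ cong (λ m → ∣ N ∣ C suc r + m * (∣ N ∣ C r)) (∣∁p∣≡n∸∣p∣ N) ⟩
    ∣ N ∣ C suc r + (n ∸ ∣ N ∣) * (∣ N ∣ C r)   ≡⟨ cong (λ k → k C suc r + (n ∸ k) * (k C r)) ∣N∣≡s-2 ⟩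
    (s ∸ 2) C suc r + (n ∸ (s ∸ 2)) * ((s ∸ 2) C r) ∎)
  where
  open ≡-Reasoning
  N = nbhd G v
  ∣N∣≡s-2 : ∣ N ∣ ≡ s ∸ 2
  ∣N∣≡s-2 = trans (sym (degree≡∣nbhd∣ G v)) deg-v≡s-2
  s≡2+∣N∣ : s ≡ 2 + ∣ N ∣
  s≡2+∣N∣ = trans (sym (ℕₚ.m+[n∸m]≡n (ℕₚ.≤-trans 2≤r (ℕₚ.<⇒≤ r<s)))) (cong (2 +_) (sym ∣N∣≡s-2))
  open LowDegreeVertex {G = G} sat v s≡2+∣N∣ using (join)
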